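{- Let $n\ge 1$, $q\ge 2$, $d$ and $s$ be integers with $0\leq d\leq n$, $s\ge 0$ and $d+s\leq n$. Let $\mathcal{V}\subseteq \{0,1,\ldots,q-1\}^n$ be a $d$-Hamming tuple system that shatters no subset of $[n]$ of size $s+1$. Then $$|\mathcal{V}|\leq {n\choose s} \sum_{i=0}^d {n-s \choose i}(q-2)^i.$$
   Context: $[n]=\{1,\ldots,n\}$ and $(q)=\{0,1,\ldots,q-1\}$. A tuple $\mathbf v\in(q)^n$ is viewed as a function $[n]\to(q)$. $\mathcal{V}\subseteq(q)^n$ shatters $S\subseteq[n]$ if $\{\mathbf v|_S:\mathbf v\in\mathcal V\}$ is the set of all functions $S\to (q)$. $\mathcal V$ is $d$-Hamming if $|\{i\in[n]: v_i\neq 0\}|=d$ for every $(v_1,\ldots,v_n)\in\mathcal V$. Convention: $0^0=1$. -}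

module Defs where

open import Data.Nat using (ℕ; zero; suc; _+_; _*_; _∸_; _^_)
open import Data.Nat.Combinatorics using (_C_)
open import Data.Fin using (Fin; zero; suc)
open import Data.Fin.Subset using (Subset; _∈_)
open import Data.Vec using (Vec; []; _∷_; lookup)
open import Data.List using (List)
import Data.List.Membership.Propositional as LM
open import Data.Product using (∃; _×_)
open import Relation.Binary.PropositionalEquality using (_≡_)

Tuple : ℕ → ℕ → Set
Tuple q n = Vec (Fin q) n

weight : ∀ {q n} → Tuple q n → ℕ
weight [] = 0
weight (zero ∷ v) = weight v
weight (suc _ ∷ v) = suc (weight v)

-- A tuple system (given as a list of tuples, assumed duplicate-free in the
-- statement) is d-Hamming if every member has exactly d nonzero coordinates.
IsHamming : ∀ {q n} → ℕ → List (Tuple q n) → Set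
IsHamming d 𝒱 = ∀ v → v LM.∈ 𝒱 → weight v ≡ d

-- A function S → (q) is represented by any total function
-- Fin n → Fin q (only its values on S matter; every function on S extends).
Shatters : ∀ {q n} → List (Tuple q n) → Subset n → Set
Shatters {q} {n} 𝒱 S =
  (f : Fin n → Fin q) → ∃ λ v → v LM.∈ 𝒱 × (∀ i → i ∈ S → lookup v i ≡ f i)

sumTo : ℕ → (ℕ → ℕ) → ℕ
sumTo zero g = g 0
sumTo (suc d) g = sumTo d g + g (suc d)

bound : ℕ → ℕ → ℕ → ℕ → ℕ
bound n q d s = (n C s) * sumTo d (λ i → ((n ∸ s) C i) * ((q ∸ 2) ^ i))

-- Write q = 2 + r. The key of a tuple replaces its 1s by 0s. Shifting (recolouring a 1 by
-- some colour 2 + c whenever the result is not yet in the family) keeps size, weight and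
-- non-shattering, so the family V may be assumed closed under such recolourings. The bound
-- counts the pairs (T, κ) with |T| = s and κ a key of weight ≤ d vanishing on T; if V is
-- larger, a nonzero integer combination L of members of V annihilates every indicator
-- v ↦ [key v = κ and v vanishes on T]. Fix v₀ in the support of L with key κ₀ and let Z S
-- be the L-weight of members with key κ₀ vanishing on S. Then Z S = 0 whenever |S| ≤ s,
-- but Z (zeros v₀) ≠ 0. For X of least size with Z X ≠ 0, inclusion–exclusion over X
-- yields, for each f, a member with key κ₀ that vanishes exactly where f does on X; it is 1
-- on the rest of X, and closedness recolours it to f. So V shatters X, and |X| > s.

module Submission where

open import Defs
open import Data.Nat using (ℕ; zero; suc; _+_; _*_; _^_; _∸_; _≤_; _<_; z≤n; s≤s)
open import Data.Nat.Combinatorics using (_C_; nCk+nC[k+1]≡[n+1]C[k+1])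
open import Data.Nat.Tactic.RingSolver using () renaming (solve-∀ to ℕ-solve-∀)
import Data.Nat.Properties as ℕ
open import Data.Integer as ℤ using (ℤ; +_; 0ℤ; 1ℤ)
import Data.Integer.Properties as ℤ
open import Data.Integer.Tactic.RingSolver using (solve-∀)
open import Data.Bool using (Bool; true; false; _∧_; not)
import Data.Bool.Properties as Bool
open import Data.Fin using (Fin; zero; suc)
import Data.Fin.Properties as Fin
open import Data.Fin.Subset using (Subset; ⁅_⁆; _∪_; _∩_; ∣_∣; ∁; _⊆_) renaming (_∈_ to _∈ˢ_; _∉_ to _∉ˢ_; ⊥ to ∅)
import Data.Fin.Subset.Properties as Subset
open import Data.Vec using (Vec; []; _∷_; lookup; _[_]≔_; here; there)
import Data.Vec as Vec
import Data.Vec.Properties as Vec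
open import Data.List using (List; []; _∷_; [_]; _++_; length; map; concatMap; allFin; filter)
import Data.List.Properties as List
open import Data.List.Relation.Unary.All as All using (All; []; _∷_; all?)
open import Data.List.Relation.Unary.All.Properties using (¬All⇒Any¬)
open import Data.List.Relation.Unary.Any as Any using (Any; here; there)
open import Data.List.Membership.Propositional using (_∈_; _∉_; find)
open import Data.List.Membership.Propositional.Properties
  using (∈-map⁺; ∈-map⁻; ∈-++⁺ˡ; ∈-++⁺ʳ; ∈-++⁻; ∈-concatMap⁺; ∈-allFin; ∈-filter⁺; ∈-filter⁻)
open import Data.List.Relation.Unary.Unique.Propositional using (Unique)
import Data.List.Relation.Unary.Unique.Propositional.Properties as Unique
open import Data.List.Relation.Unary.AllPairs using ([]; _∷_)
open import Data.Product using (∃; _×_; _,_; proj₁; proj₂; map₁)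
open import Data.Sum using (_⊎_; inj₁; inj₂; [_,_]′)
open import Data.Empty using (⊥; ⊥-elim)
open import Relation.Nullary using (¬_; Dec; yes; no; does)
open import Relation.Nullary.Decidable using (dec-true; decidable-stable; _×-dec_; ¬?)
open import Algebra.Properties.Semiring.Sum ℤ.+-*-semiring
  using (sum-syntax; sum-cong-≗; *-distribˡ-sum; *-distribʳ-sum)
open import Relation.Binary.PropositionalEquality hiding ([_])
open import Relation.Unary using (Decidable)
open import Function using (_∘_; id)

private variable
  A : Set
  k n r : ℕ

-- Integer combinations

Combination : Set → Set
Combination A = List (ℤ × A)

support : Combination A → List A
support = map proj₂

⟪_,_⟫ : Combination A → (A → ℤ) → ℤ
⟪ [] , f ⟫ = 0ℤ
⟪ (c , a) ∷ L , f ⟫ = c ℤ.* f a ℤ.+ ⟪ L , f ⟫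

⟪⟫-cong : ∀ (L : Combination A) {f g} → (∀ {p} → p ∈ L → f (proj₂ p) ≡ g (proj₂ p)) → ⟪ L , f ⟫ ≡ ⟪ L , g ⟫
⟪⟫-cong [] f≗g = refl
⟪⟫-cong (p ∷ L) f≗g = cong₂ (λ x y → proj₁ p ℤ.* x ℤ.+ y) (f≗g (here refl)) (⟪⟫-cong L (f≗g ∘ there))

⟪⟫-vanishes : ∀ (L : Combination A) {f} → (∀ {p} → p ∈ L → f (proj₂ p) ≡ 0ℤ) → ⟪ L , f ⟫ ≡ 0ℤ
⟪⟫-vanishes [] f≡0 = refl
⟪⟫-vanishes ((c , a) ∷ L) f≡0
  rewrite f≡0 (here refl) | ⟪⟫-vanishes L (λ p∈ → f≡0 (there p∈)) = trans (ℤ.+-identityʳ _) (ℤ.*-zeroʳ c)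

⟪⟫-+ : ∀ (L : Combination A) f g → ⟪ L , (λ x → f x ℤ.+ g x) ⟫ ≡ ⟪ L , f ⟫ ℤ.+ ⟪ L , g ⟫
⟪⟫-+ [] f g = refl
⟪⟫-+ ((c , a) ∷ L) f g rewrite ⟪⟫-+ L f g = lemma c (f a) (g a) ⟪ L , f ⟫ ⟪ L , g ⟫
  where
  lemma : ∀ c x y F G → c ℤ.* (x ℤ.+ y) ℤ.+ (F ℤ.+ G) ≡ c ℤ.* x ℤ.+ F ℤ.+ (c ℤ.* y ℤ.+ G)
  lemma = solve-∀

⟪⟫-- : ∀ (L : Combination A) f g → ⟪ L , (λ x → f x ℤ.- g x) ⟫ ≡ ⟪ L , f ⟫ ℤ.- ⟪ L , g ⟫
⟪⟫-- [] f g = refl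
⟪⟫-- ((c , a) ∷ L) f g rewrite ⟪⟫-- L f g = lemma c (f a) (g a) ⟪ L , f ⟫ ⟪ L , g ⟫
  where
  lemma : ∀ c x y F G → c ℤ.* (x ℤ.- y) ℤ.+ (F ℤ.- G) ≡ c ℤ.* x ℤ.+ F ℤ.- (c ℤ.* y ℤ.+ G)
  lemma = solve-∀

⟪⟫-*ˡ : ∀ (L : Combination A) k f → ⟪ L , (λ x → k ℤ.* f x) ⟫ ≡ k ℤ.* ⟪ L , f ⟫
⟪⟫-*ˡ [] k f = sym (ℤ.*-zeroʳ k)
⟪⟫-*ˡ ((c , a) ∷ L) k f rewrite ⟪⟫-*ˡ L k f = lemma c k (f a) ⟪ L , f ⟫
  where
  lemma : ∀ c k x F → c ℤ.* (k ℤ.* x) ℤ.+ k ℤ.* F ≡ k ℤ.* (c ℤ.* x ℤ.+ F)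
  lemma = solve-∀

⟪⟫-∑ : ∀ (L : Combination A) n (g : Fin n → A → ℤ) → ⟪ L , (λ x → ∑[ j < n ] g j x) ⟫ ≡ ∑[ j < n ] ⟪ L , g j ⟫
⟪⟫-∑ L zero g = ⟪⟫-vanishes L (λ _ → refl)
⟪⟫-∑ L (suc n) g = trans (⟪⟫-+ L (g zero) _) (cong (ℤ._+_ ⟪ L , g zero ⟫) (⟪⟫-∑ L n (g ∘ suc)))

scale : ℤ → Combination A → Combination A
scale k = map (map₁ (k ℤ.*_))

⟪scale⟫ : ∀ k (L : Combination A) f → ⟪ scale k L , f ⟫ ≡ k ℤ.* ⟪ L , f ⟫
⟪scale⟫ k [] f = sym (ℤ.*-zeroʳ k)
⟪scale⟫ k ((c , a) ∷ L) f rewrite ⟪scale⟫ k L f = lemma k c (f a) ⟪ L , f ⟫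
  where
  lemma : ∀ k c x F → k ℤ.* c ℤ.* x ℤ.+ k ℤ.* F ≡ k ℤ.* (c ℤ.* x ℤ.+ F)
  lemma = solve-∀

support-scale : ∀ k (L : Combination A) → support (scale k L) ≡ support L
support-scale k [] = refl
support-scale k (p ∷ L) = cong (proj₂ p ∷_) (support-scale k L)

⟪⟫≢0⇒∃ : ∀ (L : Combination A) f → ⟪ L , f ⟫ ≢ 0ℤ → ∃ λ p → p ∈ L × f (proj₂ p) ≢ 0ℤ
⟪⟫≢0⇒∃ L f ⟪⟫≢0 with all? (λ p → f (proj₂ p) ℤ.≟ 0ℤ) L
... | yes all0 = ⊥-elim (⟪⟫≢0 (⟪⟫-vanishes L (All.lookup all0)))
... | no ¬all0 = find (¬All⇒Any¬ (λ p → f (proj₂ p) ℤ.≟ 0ℤ) L ¬all0)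

⟪⟫-point : ∀ (L : Combination A) f {c v} → Unique (support L) → (c , v) ∈ L →
  f v ≡ 1ℤ → (∀ {p} → p ∈ L → proj₂ p ≢ v → f (proj₂ p) ≡ 0ℤ) → ⟪ L , f ⟫ ≡ c
⟪⟫-point ((c , v) ∷ L) f (v∉ ∷ _) (here refl) fv≡1 f≡0
  rewrite fv≡1 | ⟪⟫-vanishes L (λ p∈ → f≡0 (there p∈) (λ e → All.lookup v∉ (∈-map⁺ proj₂ p∈) (sym e))) =
  trans (ℤ.+-identityʳ _) (ℤ.*-identityʳ c)
⟪⟫-point ((c′ , v′) ∷ L) f (v′∉ ∷ u) (there p∈) fv≡1 f≡0
  rewrite f≡0 (here refl) (λ e → All.lookup v′∉ (∈-map⁺ proj₂ p∈) e) | ℤ.*-zeroʳ c′ =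
  trans (ℤ.+-identityˡ _) (⟪⟫-point L f u p∈ fv≡1 (λ q → f≡0 (there q)))

+m*i≡+n*i⇒i≡0 : ∀ {m n} i → + m ℤ.* i ≡ + n ℤ.* i → m ≢ n → i ≡ 0ℤ
+m*i≡+n*i⇒i≡0 i eq m≢n with i ℤ.≟ 0ℤ
... | yes i≡0 = i≡0
... | no i≢0 = ⊥-elim (m≢n (ℤ.+-injective (ℤ.*-cancelʳ-≡ _ _ i {{ℤ.≢-nonZero i≢0}} eq)))

⟦_⟧ : Bool → ℤ
⟦ true ⟧ = 1ℤ
⟦ false ⟧ = 0ℤ

⟦∧⟧ : ∀ a b → ⟦ a ∧ b ⟧ ≡ ⟦ a ⟧ ℤ.* ⟦ b ⟧
⟦∧⟧ true true = refl
⟦∧⟧ true false = refl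
⟦∧⟧ false b = refl

record Annihilator (Φ : List (A → ℤ)) (V : List A) : Set where
  field
    combination : Combination A
    supported : ∀ {p} → p ∈ combination → proj₂ p ∈ V
    support-unique : Unique (support combination)
    nontrivial : ∃ λ p → p ∈ combination × proj₁ p ≢ 0ℤ
    annihilates : All (λ φ → ⟪ combination , φ ⟫ ≡ 0ℤ) Φ

module _ {Φ : List (A → ℤ)} where
  open Annihilator

  annihilator-mono : ∀ {V W} → (∀ {x} → x ∈ V → x ∈ W) → Annihilator Φ V → Annihilator Φ W
  annihilator-mono V⊆W 𝒜 = record
    { combination = combination 𝒜
    ; supported = V⊆W ∘ supported 𝒜
    ; support-unique = support-unique 𝒜
    ; nontrivial = nontrivial 𝒜
    ; annihilates = annihilates 𝒜
    }

  annihilator-∷-vanishing : ∀ {V φ} → (∀ {v} → v ∈ V → φ v ≡ 0ℤ) → Annihilator Φ V → Annihilator (φ ∷ Φ) V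
  annihilator-∷-vanishing φ≡0 𝒜 = record
    { combination = combination 𝒜
    ; supported = supported 𝒜
    ; support-unique = support-unique 𝒜
    ; nontrivial = nontrivial 𝒜
    ; annihilates = ⟪⟫-vanishes (combination 𝒜) (φ≡0 ∘ supported 𝒜) ∷ annihilates 𝒜
    }

eliminate : (A → ℤ) → A → (A → ℤ) → A → ℤ
eliminate φ v ψ x = φ v ℤ.* ψ x ℤ.- ψ v ℤ.* φ x

-- Each eliminate φ v ψ vanishes at v, so after rescaling by φ v the point v can be added
-- with weight −⟪ L′ , φ ⟫ to annihilate φ too.
annihilator-∷-extend : ∀ {Φ : List (A → ℤ)} {V φ v} → v ∉ V → φ v ≢ 0ℤ →
  Annihilator (map (eliminate φ v) Φ) V → Annihilator (φ ∷ Φ) (v ∷ V)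
annihilator-∷-extend {Φ = Φ} {V} {φ} {v} v∉V φv≢0 𝒜 = record
  { combination = L
  ; supported = λ { (here refl) → here refl ; (there p∈) → there (scaled-supported p∈) }
  ; support-unique = subst (λ S → Unique (v ∷ S)) (sym (support-scale a L′))
      (All.tabulate (λ y∈ v≡y → v∉V (subst (_∈ V) (sym v≡y) (support⊆ y∈))) ∷ support-unique)
  ; nontrivial = nontrivial′
  ; annihilates = annihilates-φ ∷ All.tabulate annihilates-Φ
  }
  where
  open Annihilator 𝒜 renaming (combination to L′)
  a = φ v
  X = ⟪ L′ , φ ⟫
  L = (ℤ.- X , v) ∷ scale a L′

  scaled-supported : ∀ {p} → p ∈ scale a L′ → proj₂ p ∈ V
  scaled-supported p∈ with ∈-map⁻ (map₁ (a ℤ.*_)) p∈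
  ... | _ , p′∈ , refl = supported p′∈

  support⊆ : ∀ {y} → y ∈ support L′ → y ∈ V
  support⊆ y∈ with ∈-map⁻ proj₂ y∈
  ... | p , p∈ , refl = supported p∈

  nontrivial′ : ∃ λ p → p ∈ L × proj₁ p ≢ 0ℤ
  nontrivial′ with nontrivial
  ... | (c , x) , p∈ , c≢0 =
    (a ℤ.* c , x) , there (∈-map⁺ (map₁ (a ℤ.*_)) p∈) , [ φv≢0 , c≢0 ]′ ∘ ℤ.i*j≡0⇒i≡0∨j≡0 a

  annihilates-φ : ⟪ L , φ ⟫ ≡ 0ℤ
  annihilates-φ rewrite ⟪scale⟫ a L′ φ = lemma X a
    where
    lemma : ∀ X a → ℤ.- X ℤ.* a ℤ.+ a ℤ.* X ≡ 0ℤ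
    lemma = solve-∀

  annihilates-Φ : ∀ {ψ} → ψ ∈ Φ → ⟪ L , ψ ⟫ ≡ 0ℤ
  annihilates-Φ {ψ} ψ∈ = begin
    ℤ.- X ℤ.* ψ v ℤ.+ ⟪ scale a L′ , ψ ⟫       ≡⟨ cong (ℤ._+_ (ℤ.- X ℤ.* ψ v)) (⟪scale⟫ a L′ ψ) ⟩
    ℤ.- X ℤ.* ψ v ℤ.+ a ℤ.* ⟪ L′ , ψ ⟫         ≡⟨ lemma X (ψ v) a ⟪ L′ , ψ ⟫ ⟩
    a ℤ.* ⟪ L′ , ψ ⟫ ℤ.- ψ v ℤ.* X             ≡⟨ sym (cong₂ ℤ._-_ (⟪⟫-*ˡ L′ a ψ) (⟪⟫-*ˡ L′ (ψ v) φ)) ⟩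
    ⟪ L′ , (λ x → a ℤ.* ψ x) ⟫ ℤ.- ⟪ L′ , (λ x → ψ v ℤ.* φ x) ⟫ ≡⟨ sym (⟪⟫-- L′ _ _) ⟩
    ⟪ L′ , eliminate φ v ψ ⟫                   ≡⟨ All.lookup annihilates (∈-map⁺ (eliminate φ v) ψ∈) ⟩
    0ℤ                                         ∎
    where
    open ≡-Reasoning
    lemma : ∀ X b a Y → ℤ.- X ℤ.* b ℤ.+ a ℤ.* Y ≡ a ℤ.* Y ℤ.- b ℤ.* X
    lemma = solve-∀

remove : ∀ {x} (V : List A) → Unique V → x ∈ V →
  ∃ λ V′ → Unique V′ × x ∉ V′ × (∀ {y} → y ∈ V′ → y ∈ V) × length V ≡ suc (length V′)
remove (y ∷ V) (y∉ ∷ u) (here refl) = V , u , (λ x∈ → All.lookup y∉ x∈ refl) , there , refl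
remove (y ∷ V) (y∉ ∷ u) (there x∈) with remove V u x∈
... | V′ , u′ , x∉ , V′⊆V , len =
  y ∷ V′ , All.tabulate (All.lookup y∉ ∘ V′⊆V) ∷ u′ ,
  (λ { (here refl) → All.lookup y∉ x∈ refl ; (there q) → x∉ q }) ,
  (λ { (here refl) → here refl ; (there q) → there (V′⊆V q) }) , cong suc len

-- The fuel m = length Φ is needed because the recursive call is on map (eliminate φ v) Φ.
annihilator : ∀ (Φ : List (A → ℤ)) {V} → Unique V → length Φ < length V → Annihilator Φ V
annihilator Φ = go (length Φ) Φ refl
  where
  go : ∀ m (Φ : List (A → ℤ)) {V} → length Φ ≡ m → Unique V → length Φ < length V → Annihilator Φ V
  go _ [] {v ∷ _} _ _ _ = record
    { combination = (1ℤ , v) ∷ []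
    ; supported = λ { (here refl) → here refl }
    ; support-unique = [] ∷ []
    ; nontrivial = (1ℤ , v) , here refl , λ ()
    ; annihilates = []
    }
  go (suc m) (φ ∷ Φ) {V} len uV lt with all? (λ v → φ v ℤ.≟ 0ℤ) V
  ... | yes φ≡0 = annihilator-∷-vanishing (All.lookup φ≡0) (go m Φ (ℕ.suc-injective len) uV (ℕ.<-trans (ℕ.n<1+n _) lt))
  ... | no ¬φ≡0 with find (¬All⇒Any¬ (λ v → φ v ℤ.≟ 0ℤ) V ¬φ≡0)
  ... | v , v∈V , φv≢0 with remove V uV v∈V
  ... | V′ , uV′ , v∉V′ , V′⊆V , lenV =
    annihilator-mono (λ { (here refl) → v∈V ; (there q) → V′⊆V q })
      (annihilator-∷-extend v∉V′ φv≢0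
        (go m (map (eliminate φ v) Φ) (trans (List.length-map _ Φ) (ℕ.suc-injective len)) uV′ lt′))
    where
    lt′ : length (map (eliminate φ v) Φ) < length V′
    lt′ rewrite List.length-map (eliminate φ v) Φ = ℕ.≤-pred (subst (suc (suc (length Φ)) ≤_) lenV lt)

∑⟦∈⟧ : ∀ (S : Subset n) → ∑[ j < n ] ⟦ lookup S j ⟧ ≡ + ∣ S ∣
∑⟦∈⟧ [] = refl
∑⟦∈⟧ (true ∷ S) rewrite ∑⟦∈⟧ S = refl
∑⟦∈⟧ (false ∷ S) rewrite ∑⟦∈⟧ S = refl

∪⁅⁆-absorb : ∀ (S : Subset n) {j} → j ∈ˢ S → S ∪ ⁅ j ⁆ ≡ S
∪⁅⁆-absorb (true ∷ S) here = cong (true ∷_) (Subset.∪-identityʳ S)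
∪⁅⁆-absorb (true ∷ S) (there j∈) = cong (true ∷_) (∪⁅⁆-absorb S j∈)
∪⁅⁆-absorb (false ∷ S) (there j∈) = cong (false ∷_) (∪⁅⁆-absorb S j∈)

∣∪⁅⁆∣ : ∀ (S : Subset n) {j} → j ∉ˢ S → ∣ S ∪ ⁅ j ⁆ ∣ ≡ suc ∣ S ∣
∣∪⁅⁆∣ (true ∷ S) {zero} j∉ = ⊥-elim (j∉ here)
∣∪⁅⁆∣ (false ∷ S) {zero} j∉ rewrite Subset.∪-identityʳ S = refl
∣∪⁅⁆∣ (true ∷ S) {suc j} j∉ = cong suc (∣∪⁅⁆∣ S (j∉ ∘ there))
∣∪⁅⁆∣ (false ∷ S) {suc j} j∉ = ∣∪⁅⁆∣ S (j∉ ∘ there)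

minimal-subset : ∀ {P : Subset n → Set} → Decidable P → ∀ {X} → P X → ∃ λ Y → P Y × (∀ Z → ∣ Z ∣ < ∣ Y ∣ → ¬ P Z)
minimal-subset {n} {P} P? {X} = go n X (Subset.∣p∣≤n X)
  where
  go : ∀ m X → ∣ X ∣ ≤ m → P X → ∃ λ Y → P Y × (∀ Z → ∣ Z ∣ < ∣ Y ∣ → ¬ P Z)
  go m X ∣X∣≤m PX with Subset.anySubset? (λ Y → (∣ Y ∣ ℕ.<? ∣ X ∣) ×-dec P? Y)
  ... | no none = X , PX , λ Z lt PZ → none (Z , lt , PZ)
  go zero X ∣X∣≤0 PX | yes (Y , lt , PY) = ⊥-elim (ℕ.n≮0 (ℕ.<-≤-trans lt ∣X∣≤0))
  go (suc m) X ∣X∣≤1+m PX | yes (Y , lt , PY) = go m Y (ℕ.≤-pred (ℕ.≤-trans lt ∣X∣≤1+m)) PY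

subset-of-size : ∀ (X : Subset n) {k} → k ≤ ∣ X ∣ → ∃ λ Y → Y ⊆ X × ∣ Y ∣ ≡ k
subset-of-size {n} X {zero} _ = ∅ , (λ x∈ → ⊥-elim (Subset.∉⊥ x∈)) , Subset.∣⊥∣≡0 n
subset-of-size (true ∷ X) {suc k} (s≤s k≤) with subset-of-size X k≤
... | Y , Y⊆X , ∣Y∣≡k = true ∷ Y , (λ { here → here ; (there i∈) → there (Y⊆X i∈) }) , cong suc ∣Y∣≡k
subset-of-size (false ∷ X) {suc k} k≤ with subset-of-size X k≤
... | Y , Y⊆X , ∣Y∣≡k = false ∷ Y , (λ { (there i∈) → there (Y⊆X i∈) }) , ∣Y∣≡k

subsetsOfSize : ∀ n → ℕ → List (Subset n)
subsetsOfSize zero zero = [ [] ]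
subsetsOfSize zero (suc k) = []
subsetsOfSize (suc n) zero = map (false ∷_) (subsetsOfSize n zero)
subsetsOfSize (suc n) (suc k) = map (true ∷_) (subsetsOfSize n k) ++ map (false ∷_) (subsetsOfSize n (suc k))

length-subsetsOfSize : ∀ n k → length (subsetsOfSize n k) ≡ n C k
length-subsetsOfSize zero zero = refl
length-subsetsOfSize zero (suc k) = refl
length-subsetsOfSize (suc n) zero = trans (List.length-map _ (subsetsOfSize n zero)) (length-subsetsOfSize n zero)
length-subsetsOfSize (suc n) (suc k) = begin
  length (map (true ∷_) (subsetsOfSize n k) ++ map (false ∷_) (subsetsOfSize n (suc k)))
    ≡⟨ List.length-++ (map (true ∷_) (subsetsOfSize n k)) ⟩
  length (map (true ∷_) (subsetsOfSize n k)) + length (map (false ∷_) (subsetsOfSize n (suc k)))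
    ≡⟨ cong₂ _+_ (List.length-map _ (subsetsOfSize n k)) (List.length-map _ (subsetsOfSize n (suc k))) ⟩
  length (subsetsOfSize n k) + length (subsetsOfSize n (suc k))
    ≡⟨ cong₂ _+_ (length-subsetsOfSize n k) (length-subsetsOfSize n (suc k)) ⟩
  n C k + n C suc k
    ≡⟨ nCk+nC[k+1]≡[n+1]C[k+1] n k ⟩
  suc n C suc k ∎
  where open ≡-Reasoning

∈-subsetsOfSize : ∀ (S : Subset n) → S ∈ subsetsOfSize n ∣ S ∣
∈-subsetsOfSize [] = here refl
∈-subsetsOfSize (true ∷ S) = ∈-++⁺ˡ (∈-map⁺ (true ∷_) (∈-subsetsOfSize S))
∈-subsetsOfSize {suc n} (false ∷ S) with ∣ S ∣ | ∈-subsetsOfSize S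
... | zero | S∈ = ∈-map⁺ (false ∷_) S∈
... | suc k | S∈ = ∈-++⁺ʳ (map (true ∷_) (subsetsOfSize n k)) (∈-map⁺ (false ∷_) S∈)

size-subsetsOfSize : ∀ {n k} {S : Subset n} → S ∈ subsetsOfSize n k → ∣ S ∣ ≡ k
size-subsetsOfSize {zero} {zero} (here refl) = refl
size-subsetsOfSize {suc n} {zero} S∈ with ∈-map⁻ (false ∷_) S∈
... | _ , S′∈ , refl = size-subsetsOfSize S′∈
size-subsetsOfSize {suc n} {suc k} S∈ with ∈-++⁻ (map (true ∷_) (subsetsOfSize n k)) S∈
... | inj₁ S∈ˡ with ∈-map⁻ (true ∷_) S∈ˡ
...   | _ , S′∈ , refl = cong suc (size-subsetsOfSize S′∈)
size-subsetsOfSize {suc n} {suc k} S∈ | inj₂ S∈ʳ with ∈-map⁻ (false ∷_) S∈ʳ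
...   | _ , S′∈ , refl = size-subsetsOfSize S′∈

-- Keys and test functions

Tup : ℕ → ℕ → Set
Tup r n = Tuple (2 + r) n

one : Fin (2 + r)
one = suc zero

isZero : Fin (suc k) → Bool
isZero zero = true
isZero (suc _) = false

zeroOn : Subset n → Vec (Fin (suc k)) n → Bool
zeroOn [] [] = true
zeroOn (true ∷ T) (x ∷ v) = isZero x ∧ zeroOn T v
zeroOn (false ∷ T) (x ∷ v) = zeroOn T v

zeros : Vec (Fin (suc k)) n → Subset n
zeros = Vec.map isZero

eraseOne : Fin (2 + r) → Fin (2 + r)
eraseOne zero = zero
eraseOne (suc zero) = zero
eraseOne (suc (suc c)) = suc (suc c)

key : Tup r n → Tup r n
key = Vec.map eraseOne

hasKey : Tup r n → Tup r n → Bool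
hasKey κ v = does (Vec.≡-dec Fin._≟_ (key v) κ)

test : Subset n → Tup r n → Tup r n → ℤ
test T κ v = ⟦ hasKey κ v ∧ zeroOn T v ⟧

hasKey⇒≡ : ∀ (κ v : Tup r n) → hasKey κ v ≡ true → key v ≡ κ
hasKey⇒≡ κ v _ with Vec.≡-dec Fin._≟_ (key v) κ
hasKey⇒≡ κ v _ | yes key≡κ = key≡κ

hasKey-key : ∀ (v : Tup r n) → hasKey (key v) v ≡ true
hasKey-key v = dec-true (Vec.≡-dec Fin._≟_ (key v) (key v)) refl

eraseOne≢one : ∀ (x : Fin (2 + r)) → eraseOne x ≢ one
eraseOne≢one zero ()
eraseOne≢one (suc zero) ()
eraseOne≢one (suc (suc x)) ()

eraseOne≡zero : ∀ (x : Fin (2 + r)) → eraseOne x ≡ zero → x ≢ zero → x ≡ one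
eraseOne≡zero zero _ x≢0 = ⊥-elim (x≢0 refl)
eraseOne≡zero (suc zero) _ _ = refl

∈-zeros⁺ : ∀ (v : Vec (Fin (suc k)) n) {i} → lookup v i ≡ zero → i ∈ˢ zeros v
∈-zeros⁺ (zero ∷ v) {zero} _ = here
∈-zeros⁺ (x ∷ v) {suc i} vi≡0 = there (∈-zeros⁺ v vi≡0)

∈-zeros⁻ : ∀ (v : Vec (Fin (suc k)) n) {i} → i ∈ˢ zeros v → lookup v i ≡ zero
∈-zeros⁻ (zero ∷ v) here = refl
∈-zeros⁻ (x ∷ v) (there i∈) = ∈-zeros⁻ v i∈

zeroOn-sound : ∀ (T : Subset n) (v : Vec (Fin (suc k)) n) → zeroOn T v ≡ true → ∀ {j} → j ∈ˢ T → lookup v j ≡ zero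
zeroOn-sound (true ∷ T) (zero ∷ v) _ here = refl
zeroOn-sound (true ∷ T) (zero ∷ v) zT (there j∈) = zeroOn-sound T v zT j∈
zeroOn-sound (false ∷ T) (x ∷ v) zT (there j∈) = zeroOn-sound T v zT j∈

zeroOn-∪⁅⁆ : ∀ (T : Subset n) (v : Vec (Fin (suc k)) n) j → zeroOn (T ∪ ⁅ j ⁆) v ≡ zeroOn T v ∧ isZero (lookup v j)
zeroOn-∪⁅⁆ (true ∷ T) (x ∷ v) zero rewrite Subset.∪-identityʳ T with isZero x
... | true = sym (Bool.∧-identityʳ (zeroOn T v))
... | false = refl
zeroOn-∪⁅⁆ (false ∷ T) (x ∷ v) zero rewrite Subset.∪-identityʳ T = Bool.∧-comm (isZero x) (zeroOn T v)
zeroOn-∪⁅⁆ (true ∷ T) (x ∷ v) (suc j) rewrite zeroOn-∪⁅⁆ T v j = sym (Bool.∧-assoc (isZero x) (zeroOn T v) _)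
zeroOn-∪⁅⁆ (false ∷ T) (x ∷ v) (suc j) = zeroOn-∪⁅⁆ T v j

zeroOn-key : ∀ (T : Subset n) (v : Tup r n) → zeroOn T v ≡ true → zeroOn T (key v) ≡ true
zeroOn-key [] [] _ = refl
zeroOn-key (true ∷ T) (zero ∷ v) zT = zeroOn-key T v zT
zeroOn-key (false ∷ T) (x ∷ v) zT = zeroOn-key T v zT

zeroOn-zeros : ∀ (v : Vec (Fin (suc k)) n) → zeroOn (zeros v) v ≡ true
zeroOn-zeros [] = refl
zeroOn-zeros (zero ∷ v) = zeroOn-zeros v
zeroOn-zeros (suc x ∷ v) = zeroOn-zeros v

zeroOn-zeros⇒weight≤ : ∀ (u v : Vec (Fin (suc k)) n) → zeroOn (zeros u) v ≡ true → weight v ≤ weight u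
zeroOn-zeros⇒weight≤ [] [] _ = z≤n
zeroOn-zeros⇒weight≤ (zero ∷ u) (zero ∷ v) z = zeroOn-zeros⇒weight≤ u v z
zeroOn-zeros⇒weight≤ (suc x ∷ u) (zero ∷ v) z = ℕ.m≤n⇒m≤1+n (zeroOn-zeros⇒weight≤ u v z)
zeroOn-zeros⇒weight≤ (suc x ∷ u) (suc y ∷ v) z = s≤s (zeroOn-zeros⇒weight≤ u v z)

weight≤length : ∀ (v : Vec (Fin (suc k)) n) → weight v ≤ n
weight≤length [] = z≤n
weight≤length (zero ∷ v) = ℕ.m≤n⇒m≤1+n (weight≤length v)
weight≤length (suc x ∷ v) = s≤s (weight≤length v)

weight-key : ∀ (v : Tup r n) → weight (key v) ≤ weight v
weight-key [] = z≤n
weight-key (zero ∷ v) = weight-key v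
weight-key (suc zero ∷ v) = ℕ.m≤n⇒m≤1+n (weight-key v)
weight-key (suc (suc x) ∷ v) = s≤s (weight-key v)

weight-recolour : ∀ (v : Tup r n) j (c : Fin r) → lookup v j ≡ one → weight (v [ j ]≔ suc (suc c)) ≡ weight v
weight-recolour (suc zero ∷ v) zero c refl = refl
weight-recolour (zero ∷ v) (suc j) c vj≡1 = weight-recolour v j c vj≡1
weight-recolour (suc x ∷ v) (suc j) c vj≡1 = cong suc (weight-recolour v j c vj≡1)

∑⟦isZero⟧ : ∀ (v : Vec (Fin (suc k)) n) → ∑[ j < n ] ⟦ isZero (lookup v j) ⟧ ≡ + (n ∸ weight v)
∑⟦isZero⟧ [] = refl
∑⟦isZero⟧ (zero ∷ v) rewrite ∑⟦isZero⟧ v = cong +_ (sym (ℕ.+-∸-assoc 1 (weight≤length v)))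
∑⟦isZero⟧ (suc x ∷ v) rewrite ∑⟦isZero⟧ v = refl

-- Among tuples of equal weight, the key and the zero set pin a tuple down: a 1 of u can
-- only become a 0 of v, and that would lower the weight.
key-zeros-injective : ∀ (u v : Tup r n) → weight v ≡ weight u → key v ≡ key u → zeroOn (zeros u) v ≡ true → v ≡ u
key-zeros-injective [] [] _ _ _ = refl
key-zeros-injective (zero ∷ u) (zero ∷ v) w k z = cong (zero ∷_) (key-zeros-injective u v w (Vec.∷-injectiveʳ k) z)
key-zeros-injective (suc zero ∷ u) (zero ∷ v) w k z =
  ⊥-elim (ℕ.1+n≰n (subst (_≤ weight u) w (zeroOn-zeros⇒weight≤ u v z)))
key-zeros-injective (suc zero ∷ u) (suc zero ∷ v) w k z =
  cong (one ∷_) (key-zeros-injective u v (ℕ.suc-injective w) (Vec.∷-injectiveʳ k) z)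
key-zeros-injective (suc (suc x) ∷ u) (zero ∷ v) w k z with Vec.∷-injectiveˡ k
... | ()
key-zeros-injective (suc (suc x) ∷ u) (suc zero ∷ v) w k z with Vec.∷-injectiveˡ k
... | ()
key-zeros-injective (suc zero ∷ u) (suc (suc y) ∷ v) w k z with Vec.∷-injectiveˡ k
... | ()
key-zeros-injective (suc (suc x) ∷ u) (suc (suc y) ∷ v) w k z with Vec.∷-injectiveˡ k
... | refl = cong (suc (suc x) ∷_) (key-zeros-injective u v (ℕ.suc-injective w) (Vec.∷-injectiveʳ k) z)

test-vanishes : ∀ (S : Subset n) (κ v : Tup r n) → zeroOn S κ ≡ false → test S κ v ≡ 0ℤ
test-vanishes S κ v zκ with hasKey κ v in k | zeroOn S v in z
... | false | _ = refl
... | true | false = refl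
... | true | true with trans (sym zκ) (subst (λ t → zeroOn S t ≡ true) (hasKey⇒≡ κ v k) (zeroOn-key S v z))
... | ()

∑-test-∪⁅⁆ : ∀ (S : Subset n) (κ v : Tup r n) → ∑[ j < n ] test (S ∪ ⁅ j ⁆) κ v ≡ + (n ∸ weight v) ℤ.* test S κ v
∑-test-∪⁅⁆ {n} S κ v = begin
  ∑[ j < n ] test (S ∪ ⁅ j ⁆) κ v                         ≡⟨ sum-cong-≗ split ⟩
  ∑[ j < n ] (test S κ v ℤ.* ⟦ isZero (lookup v j) ⟧)      ≡⟨ sym (*-distribˡ-sum {n} (test S κ v) _) ⟩
  test S κ v ℤ.* ∑[ j < n ] ⟦ isZero (lookup v j) ⟧        ≡⟨ cong (test S κ v ℤ.*_) (∑⟦isZero⟧ v) ⟩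
  test S κ v ℤ.* + (n ∸ weight v)                         ≡⟨ ℤ.*-comm (test S κ v) _ ⟩
  + (n ∸ weight v) ℤ.* test S κ v                         ∎
  where
  open ≡-Reasoning
  split : ∀ j → test (S ∪ ⁅ j ⁆) κ v ≡ test S κ v ℤ.* ⟦ isZero (lookup v j) ⟧
  split j rewrite zeroOn-∪⁅⁆ S v j | sym (Bool.∧-assoc (hasKey κ v) (zeroOn S v) (isZero (lookup v j))) =
    ⟦∧⟧ (hasKey κ v ∧ zeroOn S v) _

nonzeroOn : List (Fin n) → Vec (Fin (suc k)) n → Bool
nonzeroOn [] v = true
nonzeroOn (j ∷ D) v = not (isZero (lookup v j)) ∧ nonzeroOn D v

nonzeroOn-sound : ∀ D (v : Vec (Fin (suc k)) n) → nonzeroOn D v ≡ true → ∀ {j} → j ∈ D → lookup v j ≢ zero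
nonzeroOn-sound (j ∷ D) v nz (here refl) with lookup v j | nz
... | zero | ()
... | suc _ | _ = λ ()
nonzeroOn-sound (j ∷ D) v nz (there i∈) with lookup v j | nz
... | zero | ()
... | suc _ | nz′ = nonzeroOn-sound D v nz′ i∈

exactTest : Subset n → List (Fin n) → Tup r n → Tup r n → ℤ
exactTest B D κ v = ⟦ hasKey κ v ∧ (zeroOn B v ∧ nonzeroOn D v) ⟧

exactTest-[] : ∀ (B : Subset n) (κ v : Tup r n) → exactTest B [] κ v ≡ test B κ v
exactTest-[] B κ v = cong (λ b → ⟦ hasKey κ v ∧ b ⟧) (Bool.∧-identityʳ (zeroOn B v))

exactTest-∷ : ∀ (B : Subset n) j D (κ v : Tup r n) →
  exactTest B (j ∷ D) κ v ≡ exactTest B D κ v ℤ.- exactTest (B ∪ ⁅ j ⁆) D κ v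
exactTest-∷ B j D κ v rewrite zeroOn-∪⁅⁆ B v j = split (hasKey κ v) (zeroOn B v) (isZero (lookup v j)) (nonzeroOn D v)
  where
  split : ∀ k z y m → ⟦ k ∧ (z ∧ (not y ∧ m)) ⟧ ≡ ⟦ k ∧ (z ∧ m) ⟧ ℤ.- ⟦ k ∧ ((z ∧ y) ∧ m) ⟧
  split true true true true = refl
  split true true true false = refl
  split true true false true = refl
  split true true false false = refl
  split true false y m = refl
  split false z y m = refl

exactTest≢0 : ∀ (B : Subset n) D (κ v : Tup r n) → exactTest B D κ v ≢ 0ℤ →
  key v ≡ κ × zeroOn B v ≡ true × (∀ {j} → j ∈ D → lookup v j ≢ zero)
exactTest≢0 B D κ v ≢0 with hasKey κ v in k | zeroOn B v | nonzeroOn D v in nz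
... | false | _ | _ = ⊥-elim (≢0 refl)
... | true | false | _ = ⊥-elim (≢0 refl)
... | true | true | false = ⊥-elim (≢0 refl)
... | true | true | true = hasKey⇒≡ κ v k , refl , nonzeroOn-sound D v nz

length-concatMap-const : ∀ {B : Set} (f : A → List B) (xs : List A) {m} →
  (∀ {x} → x ∈ xs → length (f x) ≡ m) → length (concatMap f xs) ≡ length xs * m
length-concatMap-const f [] _ = refl
length-concatMap-const f (x ∷ xs) len =
  trans (List.length-++ (f x)) (cong₂ _+_ (len (here refl)) (length-concatMap-const f xs (len ∘ there)))

NoOne : Tup r n → Set
NoOne κ = ∀ j → lookup κ j ≢ one

keys : Subset n → ℕ → List (Tup r n)
keys [] zero = [ [] ]
keys [] (suc i) = []
keys (true ∷ T) i = map (zero ∷_) (keys T i)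
keys (false ∷ T) zero = map (zero ∷_) (keys T zero)
keys {r = r} (false ∷ T) (suc i) =
  map (zero ∷_) (keys T (suc i)) ++ concatMap (λ c → map (suc (suc c) ∷_) (keys T i)) (allFin r)

length-keys : ∀ (T : Subset n) i → length (keys {r = r} T i) ≡ (∣ ∁ T ∣ C i) * r ^ i
length-keys [] zero = refl
length-keys [] (suc i) = refl
length-keys {r = r} (true ∷ T) i = trans (List.length-map _ (keys {r = r} T i)) (length-keys T i)
length-keys {r = r} (false ∷ T) zero = trans (List.length-map _ (keys {r = r} T zero)) (length-keys {r = r} T zero)
length-keys {r = r} (false ∷ T) (suc i) = begin
  length (map (zero ∷_) (keys T (suc i)) ++ concatMap (λ c → map (suc (suc c) ∷_) (keys T i)) (allFin r))
    ≡⟨ List.length-++ (map (zero ∷_) (keys {r = r} T (suc i))) ⟩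
  length (map (zero ∷_) (keys T (suc i))) + length (concatMap (λ c → map (suc (suc c) ∷_) (keys T i)) (allFin r))
    ≡⟨ cong₂ _+_ (List.length-map _ (keys {r = r} T (suc i)))
         (length-concatMap-const _ (allFin r) (λ {c} _ → List.length-map (suc (suc c) ∷_) (keys {r = r} T i))) ⟩
  length (keys {r = r} T (suc i)) + length (allFin r) * length (keys {r = r} T i)
    ≡⟨ cong₂ (λ a b → a + b * length (keys {r = r} T i)) (length-keys T (suc i)) (List.length-tabulate {n = r} id) ⟩
  (m C suc i) * r ^ suc i + r * length (keys {r = r} T i)
    ≡⟨ cong (λ b → (m C suc i) * r ^ suc i + r * b) (length-keys T i) ⟩
  (m C suc i) * r ^ suc i + r * ((m C i) * r ^ i)
    ≡⟨ lemma (m C i) (m C suc i) (r ^ i) r ⟩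
  (m C i + m C suc i) * r ^ suc i
    ≡⟨ cong (_* r ^ suc i) (nCk+nC[k+1]≡[n+1]C[k+1] m i) ⟩
  (suc m C suc i) * r ^ suc i ∎
  where
  open ≡-Reasoning
  m = ∣ ∁ T ∣
  lemma : ∀ a b p r → b * (r * p) + r * (a * p) ≡ (a + b) * (r * p)
  lemma = ℕ-solve-∀

∈-keys : ∀ (T : Subset n) (κ : Tup r n) → zeroOn T κ ≡ true → NoOne κ → κ ∈ keys T (weight κ)
∈-keys [] [] _ _ = here refl
∈-keys (true ∷ T) (zero ∷ κ) zT no1 = ∈-map⁺ (zero ∷_) (∈-keys T κ zT (no1 ∘ suc))
∈-keys (false ∷ T) (zero ∷ κ) zT no1 with weight κ | ∈-keys T κ zT (no1 ∘ suc)
... | zero | κ∈ = ∈-map⁺ (zero ∷_) κ∈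
... | suc i | κ∈ = ∈-++⁺ˡ (∈-map⁺ (zero ∷_) κ∈)
∈-keys (false ∷ T) (suc zero ∷ κ) _ no1 = ⊥-elim (no1 zero refl)
∈-keys (false ∷ T) (suc (suc c) ∷ κ) zT no1 =
  ∈-++⁺ʳ (map (zero ∷_) (keys T (suc (weight κ))))
    (∈-concatMap⁺ (λ c → map (suc (suc c) ∷_) (keys T (weight κ)))
      (Any.map (λ { refl → ∈-map⁺ (suc (suc c) ∷_) (∈-keys T κ zT (no1 ∘ suc)) }) (∈-allFin c)))

keysUpTo : Subset n → ℕ → List (Tup r n)
keysUpTo T zero = keys T zero
keysUpTo T (suc d) = keysUpTo T d ++ keys T (suc d)

length-keysUpTo : ∀ (T : Subset n) d → length (keysUpTo {r = r} T d) ≡ sumTo d (λ i → (∣ ∁ T ∣ C i) * r ^ i)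
length-keysUpTo T zero = length-keys T zero
length-keysUpTo {r = r} T (suc d) =
  trans (List.length-++ (keysUpTo {r = r} T d)) (cong₂ _+_ (length-keysUpTo T d) (length-keys T (suc d)))

keys⊆keysUpTo : ∀ (T : Subset n) {d i} → i ≤ d → ∀ {κ : Tup r n} → κ ∈ keys T i → κ ∈ keysUpTo T d
keys⊆keysUpTo T {zero} z≤n κ∈ = κ∈
keys⊆keysUpTo T {suc d} i≤1+d κ∈ with ℕ.m≤n⇒m<n∨m≡n i≤1+d
... | inj₁ i<1+d = ∈-++⁺ˡ (keys⊆keysUpTo T (ℕ.≤-pred i<1+d) κ∈)
... | inj₂ refl = ∈-++⁺ʳ (keysUpTo T d) κ∈

tests : ∀ n → ℕ → ℕ → List (Tup r n → ℤ)
tests n s d = concatMap (λ T → map (test T) (keysUpTo T d)) (subsetsOfSize n s)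

length-tests : ∀ r n s d → length (tests {r = r} n s d) ≡ bound n (2 + r) d s
length-tests r n s d =
  trans (length-concatMap-const (λ T → map (test T) (keysUpTo T d)) (subsetsOfSize n s) length-per-subset)
        (cong (_* sumTo d (λ i → ((n ∸ s) C i) * r ^ i)) (length-subsetsOfSize n s))
  where
  length-per-subset : ∀ {T} → T ∈ subsetsOfSize n s →
    length (map (test T) (keysUpTo {r = r} T d)) ≡ sumTo d (λ i → ((n ∸ s) C i) * r ^ i)
  length-per-subset {T} T∈ rewrite List.length-map (test T) (keysUpTo {r = r} T d)
                                 | length-keysUpTo {r = r} T d
                                 | Subset.∣∁p∣≡n∸∣p∣ T
                                 | size-subsetsOfSize T∈ = refl

test∈tests : ∀ {s d} (T : Subset n) (κ : Tup r n) → ∣ T ∣ ≡ s → zeroOn T κ ≡ true → NoOne κ → weight κ ≤ d →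
  test T κ ∈ tests n s d
test∈tests {n} {d = d} T κ refl zT no1 wκ≤d =
  ∈-concatMap⁺ (λ T → map (test T) (keysUpTo T d))
    (Any.map (λ { refl → ∈-map⁺ (test T) (keys⊆keysUpTo T wκ≤d (∈-keys T κ zT no1)) }) (∈-subsetsOfSize T))

-- Shifting

Closed : List (Tup r n) → Set
Closed V = ∀ {v} → v ∈ V → ∀ j c → lookup v j ≡ one → v [ j ]≔ suc (suc c) ∈ V

infix 4 _∈ᵗ?_
_∈ᵗ?_ : ∀ (v : Tup r n) V → Dec (v ∈ V)
v ∈ᵗ? V = Any.any? (Vec.≡-dec Fin._≟_ v) V

ones : Vec (Fin (2 + r)) n → ℕ
ones [] = 0
ones (zero ∷ v) = ones v
ones (suc zero ∷ v) = suc (ones v)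
ones (suc (suc x) ∷ v) = ones v

ones-recolour : ∀ (v : Tup r n) j c → lookup v j ≡ one → suc (ones (v [ j ]≔ suc (suc c))) ≡ ones v
ones-recolour (suc zero ∷ v) zero c refl = refl
ones-recolour (zero ∷ v) (suc j) c vj≡1 = ones-recolour v j c vj≡1
ones-recolour (suc zero ∷ v) (suc j) c vj≡1 = cong suc (ones-recolour v j c vj≡1)
ones-recolour (suc (suc x) ∷ v) (suc j) c vj≡1 = ones-recolour v j c vj≡1

totalOnes : List (Tup r n) → ℕ
totalOnes [] = 0
totalOnes (v ∷ V) = ones v + totalOnes V

module Shift (V : List (Tup r n)) (j : Fin n) (c : Fin r) where

  cc : Fin (2 + r)
  cc = suc (suc c)

  shift : Tup r n → Tup r n
  shift v with lookup v j Fin.≟ one | v [ j ]≔ cc ∈ᵗ? V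
  ... | yes _ | no _ = v [ j ]≔ cc
  ... | _ | _ = v

  shift-cases : ∀ v → (shift v ≡ v [ j ]≔ cc × lookup v j ≡ one × v [ j ]≔ cc ∉ V)
                    ⊎ (shift v ≡ v × (lookup v j ≡ one → v [ j ]≔ cc ∈ V))
  shift-cases v with lookup v j Fin.≟ one | v [ j ]≔ cc ∈ᵗ? V
  ... | yes vj≡1 | no ∉V = inj₁ (refl , vj≡1 , ∉V)
  ... | yes _ | yes ∈V = inj₂ (refl , λ _ → ∈V)
  ... | no vj≢1 | _ = inj₂ (refl , ⊥-elim ∘ vj≢1)

  weight-shift : ∀ v → weight (shift v) ≡ weight v
  weight-shift v with shift-cases v
  ... | inj₁ (e , vj≡1 , _) = trans (cong weight e) (weight-recolour v j c vj≡1)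
  ... | inj₂ (e , _) = cong weight e

  shift-injective : ∀ {u v} → u ∈ V → v ∈ V → shift u ≡ shift v → u ≡ v
  shift-injective {u} {v} u∈ v∈ e with shift-cases u | shift-cases v
  ... | inj₁ (eu , uj≡1 , _) | inj₁ (ev , vj≡1 , _) = begin
    u                          ≡⟨ restore u uj≡1 ⟨
    (u [ j ]≔ cc) [ j ]≔ one   ≡⟨ cong (_[ j ]≔ one) (trans (sym eu) (trans e ev)) ⟩
    (v [ j ]≔ cc) [ j ]≔ one   ≡⟨ restore v vj≡1 ⟩
    v                          ∎
    where
    open ≡-Reasoning
    restore : ∀ w → lookup w j ≡ one → (w [ j ]≔ cc) [ j ]≔ one ≡ w
    restore w wj≡1 = trans (Vec.[]≔-idempotent w j) (trans (cong (w [ j ]≔_) (sym wj≡1)) (Vec.[]≔-lookup w j))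
  ... | inj₁ (eu , _ , ∉V) | inj₂ (ev , _) = ⊥-elim (∉V (subst (_∈ V) (sym (trans (sym eu) (trans e ev))) v∈))
  ... | inj₂ (eu , _) | inj₁ (ev , _ , ∉V) = ⊥-elim (∉V (subst (_∈ V) (trans (sym eu) (trans e ev)) u∈))
  ... | inj₂ (eu , _) | inj₂ (ev , _) = trans (sym eu) (trans e ev)

  unique-shift : ∀ {W} → (∀ {w} → w ∈ W → w ∈ V) → Unique W → Unique (map shift W)
  unique-shift {[]} _ _ = []
  unique-shift {w ∷ W} W⊆V (w∉ ∷ uW) =
    All.tabulate (λ y∈ e → let (u , u∈ , y≡) = ∈-map⁻ shift y∈ in
      All.lookup w∉ u∈ (shift-injective (W⊆V (here refl)) (W⊆V (there u∈)) (trans e y≡)))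
    ∷ unique-shift (W⊆V ∘ there) uW

  ones-shift-≤ : ∀ v → ones (shift v) ≤ ones v
  ones-shift-≤ v with shift-cases v
  ... | inj₁ (e , vj≡1 , _) rewrite e | sym (ones-recolour v j c vj≡1) = ℕ.n≤1+n _
  ... | inj₂ (e , _) rewrite e = ℕ.≤-refl

  ones-shift-< : ∀ v → lookup v j ≡ one → v [ j ]≔ cc ∉ V → ones (shift v) < ones v
  ones-shift-< v vj≡1 ∉V with shift-cases v
  ... | inj₁ (e , _ , _) rewrite e = ℕ.≤-reflexive (ones-recolour v j c vj≡1)
  ... | inj₂ (_ , closed) = ⊥-elim (∉V (closed vj≡1))

  totalOnes-shift-≤ : ∀ W → totalOnes (map shift W) ≤ totalOnes W
  totalOnes-shift-≤ [] = z≤n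
  totalOnes-shift-≤ (w ∷ W) = ℕ.+-mono-≤ (ones-shift-≤ w) (totalOnes-shift-≤ W)

  totalOnes-shift-< : ∀ W → Any (λ w → lookup w j ≡ one × w [ j ]≔ cc ∉ V) W → totalOnes (map shift W) < totalOnes W
  totalOnes-shift-< (w ∷ W) (here (wj≡1 , ∉V)) = ℕ.+-mono-<-≤ (ones-shift-< w wj≡1 ∉V) (totalOnes-shift-≤ W)
  totalOnes-shift-< (w ∷ W) (there p) = ℕ.+-mono-≤-< (ones-shift-≤ w) (totalOnes-shift-< W p)

  shift-agrees : ∀ {S : Subset n} {f : Fin n → Fin (2 + r)} u → (∀ i → i ∈ˢ S → lookup (shift u) i ≡ f i) →
    (j ∈ˢ S → f j ≢ cc) → ∀ i → i ∈ˢ S → lookup u i ≡ f i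
  shift-agrees u agrees fj≢cc i i∈ with shift-cases u
  ... | inj₂ (e , _) = trans (cong (λ t → lookup t i) (sym e)) (agrees i i∈)
  ... | inj₁ (e , _ , _) with i Fin.≟ j
  ...   | yes refl =
    ⊥-elim (fj≢cc i∈ (trans (sym (agrees i i∈)) (trans (cong (λ t → lookup t i) e) (Vec.lookup∘update i u cc))))
  ...   | no i≢j = trans (sym (Vec.lookup∘update′ i≢j u cc)) (trans (cong (λ t → lookup t i) (sym e)) (agrees i i∈))

  recolour∈ : ∀ {u} → lookup u j ≡ one → lookup (shift u) j ≢ cc → u [ j ]≔ cc ∈ V
  recolour∈ {u} uj≡1 shift≢cc with shift-cases u
  ... | inj₁ (e , _ , _) = ⊥-elim (shift≢cc (trans (cong (λ t → lookup t j) e) (Vec.lookup∘update j u cc)))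
  ... | inj₂ (_ , closed) = closed uj≡1

  oneAt-j : (Fin n → Fin (2 + r)) → Fin n → Fin (2 + r)
  oneAt-j f = lookup (Vec.tabulate f [ j ]≔ one)

  module _ {S : Subset n} (shatters : Shatters (map shift V) S) where

    preimage : ∀ f → (j ∈ˢ S → f j ≢ cc) → ∃ λ v → v ∈ V × (∀ i → i ∈ˢ S → lookup v i ≡ f i)
    preimage f fj≢cc with shatters f
    ... | w , w∈ , agrees with ∈-map⁻ shift w∈
    ... | u , u∈ , refl = u , u∈ , shift-agrees u agrees fj≢cc

    -- Realise f with j recoloured to 1, then recolour back: the shift left that tuple alone.
    recoloured : ∀ f → j ∈ˢ S → f j ≡ cc → ∃ λ v → v ∈ V × (∀ i → i ∈ˢ S → lookup v i ≡ f i)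
    recoloured f j∈ fj≡cc with shatters (oneAt-j f)
    ... | w , w∈ , agrees with ∈-map⁻ shift w∈
    ... | u , u∈ , refl = u [ j ]≔ cc , recolour∈ uj≡1 shift-uj≢cc , agrees′
      where
      oneAt-j-j : oneAt-j f j ≡ one
      oneAt-j-j = Vec.lookup∘update j (Vec.tabulate f) one
      shift-uj≢cc : lookup (shift u) j ≢ cc
      shift-uj≢cc e with trans (sym (trans (agrees j j∈) oneAt-j-j)) e
      ... | ()
      u-agrees : ∀ i → i ∈ˢ S → lookup u i ≡ oneAt-j f i
      u-agrees = shift-agrees u agrees (λ _ → shift-uj≢cc ∘ trans (agrees j j∈))
      uj≡1 : lookup u j ≡ one
      uj≡1 = trans (u-agrees j j∈) oneAt-j-j
      agrees′ : ∀ i → i ∈ˢ S → lookup (u [ j ]≔ cc) i ≡ f i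
      agrees′ i i∈ with i Fin.≟ j
      ... | yes refl = trans (Vec.lookup∘update i u cc) (sym fj≡cc)
      ... | no i≢j = begin
        lookup (u [ j ]≔ cc) i   ≡⟨ Vec.lookup∘update′ i≢j u cc ⟩
        lookup u i               ≡⟨ u-agrees i i∈ ⟩
        oneAt-j f i              ≡⟨ Vec.lookup∘update′ i≢j (Vec.tabulate f) one ⟩
        lookup (Vec.tabulate f) i ≡⟨ Vec.lookup∘tabulate f i ⟩
        f i                      ∎
        where open ≡-Reasoning

    shatters-shift⇒shatters : Shatters V S
    shatters-shift⇒shatters f with j Subset.∈? S | f j Fin.≟ cc
    ... | no j∉ | _ = preimage f (⊥-elim ∘ j∉)
    ... | yes _ | no fj≢cc = preimage f (λ _ → fj≢cc)
    ... | yes j∈ | yes fj≡cc = recoloured f j∈ fj≡cc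

record Compression (d : ℕ) (V : List (Tup r n)) : Set where
  field
    tuples : List (Tup r n)
    same-length : length tuples ≡ length V
    unique : Unique tuples
    hamming : IsHamming d tuples
    closed : Closed tuples
    reflects : ∀ S → Shatters tuples S → Shatters V S

compression-shift : ∀ {d} {V : List (Tup r n)} j c → Compression d (map (Shift.shift V j c) V) → Compression d V
compression-shift {V = V} j c 𝒞 = record
  { tuples = tuples
  ; same-length = trans same-length (List.length-map _ V)
  ; unique = unique
  ; hamming = hamming
  ; closed = closed
  ; reflects = λ S → Shift.shatters-shift⇒shatters V j c ∘ reflects S
  }
  where open Compression 𝒞

-- Shift while some 1 can be recoloured outside V; each shift lowers the number of 1s.
compress : ∀ {d} (V : List (Tup r n)) → Unique V → IsHamming d V → Compression d V
compress V = go (suc (totalOnes V)) V ℕ.≤-refl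
  where
  go : ∀ {d} fuel (V : List (Tup r n)) → totalOnes V < fuel → Unique V → IsHamming d V → Compression d V
  go (suc fuel) V lt uV ham
    with Any.any? (λ v → Fin.any? λ j → Fin.any? λ c → (lookup v j Fin.≟ one) ×-dec ¬? (v [ j ]≔ suc (suc c) ∈ᵗ? V)) V
  ... | no closed = record
    { tuples = V ; same-length = refl ; unique = uV ; hamming = ham ; reflects = λ _ → id
    ; closed = λ v∈ j c vj≡1 → decidable-stable (_ ∈ᵗ? V) (λ ∉V → closed (Any.map (λ { refl → j , c , vj≡1 , ∉V }) v∈))
    }
  ... | yes violation with find violation
  ... | w , w∈ , j , c , wj≡1 , ∉V = compression-shift j c
    (go fuel (map shift V) (ℕ.<-≤-trans (totalOnes-shift-< V (Any.map (λ { refl → wj≡1 , ∉V }) w∈)) (ℕ.≤-pred lt))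
        (unique-shift id uV) ham′)
    where
    open Shift V j c
    ham′ : IsHamming _ (map shift V)
    ham′ v v∈ with ∈-map⁻ shift v∈
    ... | u , u∈ , refl = trans (weight-shift u) (ham u u∈)

closed-recolour : ∀ {V : List (Tup r n)} → Closed V → (f : Fin n → Fin (2 + r)) (D : List (Fin n)) → Unique D →
  ∀ {v} → v ∈ V → (∀ {j} → j ∈ D → lookup v j ≡ one) → (∀ {j} → j ∈ D → f j ≢ zero) →
  ∃ λ u → u ∈ V × (∀ {j} → j ∈ D → lookup u j ≡ f j) × (∀ j → j ∉ D → lookup u j ≡ lookup v j)
closed-recolour closed f [] _ v∈ _ _ = _ , v∈ , (λ ()) , λ _ _ → refl
closed-recolour {V = V} closed f (j ∷ D) (j∉D ∷ uD) {v} v∈ v≡1 f≢0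
  with closed-recolour closed f D uD v∈ (v≡1 ∘ there) (f≢0 ∘ there)
... | u , u∈ , agrees , unchanged = recolour-j (f j) refl
  where
  uj≡1 : lookup u j ≡ one
  uj≡1 = trans (unchanged j (λ j∈ → All.lookup j∉D j∈ refl)) (v≡1 (here refl))
  recolour-j : ∀ x → f j ≡ x →
    ∃ λ u → u ∈ V × (∀ {i} → i ∈ j ∷ D → lookup u i ≡ f i) × (∀ i → i ∉ j ∷ D → lookup u i ≡ lookup v i)
  recolour-j zero fj≡0 = ⊥-elim (f≢0 (here refl) fj≡0)
  recolour-j (suc zero) fj≡1 =
    u , u∈ , (λ { (here refl) → trans uj≡1 (sym fj≡1) ; (there i∈) → agrees i∈ }) , λ i i∉ → unchanged i (i∉ ∘ there)
  recolour-j (suc (suc c)) fj≡cc =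
    u [ j ]≔ suc (suc c) , closed u∈ j c uj≡1 ,
    (λ { (here refl) → trans (Vec.lookup∘update j u _) (sym fj≡cc)
       ; (there i∈) → trans (Vec.lookup∘update′ (λ i≡j → All.lookup j∉D i∈ (sym i≡j)) u _) (agrees i∈) }) ,
    λ i i∉ → trans (Vec.lookup∘update′ (i∉ ∘ here) u _) (unchanged i (i∉ ∘ there))

-- A nontrivial annihilating combination forces a shattered set

shatters-⊆ : ∀ {V : List (Tuple k n)} {X Y} → Y ⊆ X → Shatters V X → Shatters V Y
shatters-⊆ Y⊆X shatters f with shatters f
... | v , v∈ , agrees = v , v∈ , λ i i∈ → agrees i (Y⊆X i∈)

module FromAnnihilator {r n d s} {V : List (Tup r n)} (hamming : IsHamming d V) (closed : Closed V)
  (d+s≤n : d + s ≤ n) (𝒜 : Annihilator (tests n s d) V) where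

  open Annihilator 𝒜 renaming (combination to L)

  c₀ : ℤ
  c₀ = proj₁ (proj₁ nontrivial)

  v₀ : Tup r n
  v₀ = proj₂ (proj₁ nontrivial)

  c₀v₀∈L : (c₀ , v₀) ∈ L
  c₀v₀∈L = proj₁ (proj₂ nontrivial)

  κ₀ : Tup r n
  κ₀ = key v₀

  Z : Subset n → ℤ
  Z S = ⟪ L , test S κ₀ ⟫

  weight-supported : ∀ {p} → p ∈ L → weight (proj₂ p) ≡ d
  weight-supported p∈ = hamming _ (supported p∈)

  weight-v₀ : weight v₀ ≡ d
  weight-v₀ = weight-supported c₀v₀∈L

  Z-size-s : ∀ S → ∣ S ∣ ≡ s → Z S ≡ 0ℤ
  Z-size-s S ∣S∣≡s with zeroOn S κ₀ in zκ
  ... | true = All.lookup annihilates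
                 (test∈tests S κ₀ ∣S∣≡s zκ no-one (ℕ.≤-trans (weight-key v₀) (ℕ.≤-reflexive weight-v₀)))
    where
    no-one : NoOne κ₀
    no-one j e = eraseOne≢one (lookup v₀ j) (trans (sym (Vec.lookup-map j eraseOne v₀)) e)
  ... | false = ⟪⟫-vanishes L (λ _ → test-vanishes S κ₀ _ zκ)

  ∑-Z-∪⁅⁆ : ∀ S → ∑[ j < n ] Z (S ∪ ⁅ j ⁆) ≡ + (n ∸ d) ℤ.* Z S
  ∑-Z-∪⁅⁆ S = begin
    ∑[ j < n ] Z (S ∪ ⁅ j ⁆)                         ≡⟨ ⟪⟫-∑ L n (λ j → test (S ∪ ⁅ j ⁆) κ₀) ⟨
    ⟪ L , (λ v → ∑[ j < n ] test (S ∪ ⁅ j ⁆) κ₀ v) ⟫  ≡⟨ ⟪⟫-cong L counted ⟩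
    ⟪ L , (λ v → + (n ∸ d) ℤ.* test S κ₀ v) ⟫        ≡⟨ ⟪⟫-*ˡ L (+ (n ∸ d)) (test S κ₀) ⟩
    + (n ∸ d) ℤ.* Z S                                ∎
    where
    open ≡-Reasoning
    counted : ∀ {p} → p ∈ L → ∑[ j < n ] test (S ∪ ⁅ j ⁆) κ₀ (proj₂ p) ≡ + (n ∸ d) ℤ.* test S κ₀ (proj₂ p)
    counted {p} p∈ rewrite sym (weight-supported p∈) = ∑-test-∪⁅⁆ S κ₀ (proj₂ p)

  -- Counting Σⱼ Z (S ∪ {j}) inductively gives |S|·Z S, against (n − d)·Z S above; |S| < n − d.
  Z-small : ∀ S → ∣ S ∣ ≤ s → Z S ≡ 0ℤ
  Z-small S ∣S∣≤s = go (s ∸ ∣ S ∣) S (ℕ.m+[n∸m]≡n ∣S∣≤s)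
    where
    go : ∀ m S → ∣ S ∣ + m ≡ s → Z S ≡ 0ℤ
    go zero S eq = Z-size-s S (trans (sym (ℕ.+-identityʳ _)) eq)
    go (suc m) S eq = +m*i≡+n*i⇒i≡0 (Z S) (trans (sym ∑-Z-∪⁅⁆-small) (∑-Z-∪⁅⁆ S)) ∣S∣≢n∸d
      where
      ∣S∣≢n∸d : ∣ S ∣ ≢ n ∸ d
      ∣S∣≢n∸d = ℕ.<⇒≢ (ℕ.<-≤-trans (subst (∣ S ∣ <_) eq (ℕ.m<m+n ∣ S ∣ (s≤s z≤n)))
                                   (ℕ.m+n≤o⇒m≤o∸n s (subst (_≤ n) (ℕ.+-comm d s) d+s≤n)))
      term : ∀ j → Z (S ∪ ⁅ j ⁆) ≡ ⟦ lookup S j ⟧ ℤ.* Z S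
      term j with lookup S j in Sj
      ... | true = trans (cong Z (∪⁅⁆-absorb S (Vec.lookup⇒[]= j S Sj))) (sym (ℤ.*-identityˡ (Z S)))
      ... | false = trans (go m (S ∪ ⁅ j ⁆) (trans (cong (_+ m) (∣∪⁅⁆∣ S j∉S)) (trans (sym (ℕ.+-suc _ m)) eq)))
                          (sym (ℤ.*-zeroˡ (Z S)))
        where
        j∉S : j ∉ˢ S
        j∉S j∈S with trans (sym Sj) (Vec.[]=⇒lookup j∈S)
        ... | ()
      ∑-Z-∪⁅⁆-small : ∑[ j < n ] Z (S ∪ ⁅ j ⁆) ≡ + ∣ S ∣ ℤ.* Z S
      ∑-Z-∪⁅⁆-small = begin
        ∑[ j < n ] Z (S ∪ ⁅ j ⁆)            ≡⟨ sum-cong-≗ term ⟩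
        ∑[ j < n ] (⟦ lookup S j ⟧ ℤ.* Z S) ≡⟨ *-distribʳ-sum {n} (Z S) (λ j → ⟦ lookup S j ⟧) ⟨
        ∑[ j < n ] ⟦ lookup S j ⟧ ℤ.* Z S   ≡⟨ cong (ℤ._* Z S) (∑⟦∈⟧ S) ⟩
        + ∣ S ∣ ℤ.* Z S                     ∎
        where open ≡-Reasoning

  Z-zeros-v₀ : Z (zeros v₀) ≡ c₀
  Z-zeros-v₀ = ⟪⟫-point L (test (zeros v₀) κ₀) support-unique c₀v₀∈L
    (cong₂ (λ a b → ⟦ a ∧ b ⟧) (hasKey-key v₀) (zeroOn-zeros v₀))
    (λ {p} p∈ → elsewhere (proj₂ p) (trans (weight-supported p∈) (sym weight-v₀)))
    where
    elsewhere : ∀ v → weight v ≡ weight v₀ → v ≢ v₀ → test (zeros v₀) κ₀ v ≡ 0ℤ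
    elsewhere v w v≢v₀ with hasKey κ₀ v in k | zeroOn (zeros v₀) v in z
    ... | true | true = ⊥-elim (v≢v₀ (key-zeros-injective v₀ v w (hasKey⇒≡ κ₀ v k) z))
    ... | true | false = refl
    ... | false | _ = refl

  Zₑ : Subset n → List (Fin n) → ℤ
  Zₑ B D = ⟪ L , exactTest B D κ₀ ⟫

  Zₑ-[] : ∀ B → Zₑ B [] ≡ Z B
  Zₑ-[] B = ⟪⟫-cong L (λ {p} _ → exactTest-[] B κ₀ (proj₂ p))

  Zₑ-∷ : ∀ B j D → Zₑ B (j ∷ D) ≡ Zₑ B D ℤ.- Zₑ (B ∪ ⁅ j ⁆) D
  Zₑ-∷ B j D = trans (⟪⟫-cong L (λ {p} _ → exactTest-∷ B j D κ₀ (proj₂ p))) (⟪⟫-- L _ _)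

  module Minimal (X : Subset n) (Z-X≢0 : Z X ≢ 0ℤ) (X-minimal : ∀ Y → ∣ Y ∣ < ∣ X ∣ → ¬ Z Y ≢ 0ℤ) where

    Z-below-X : ∀ Y → ∣ Y ∣ < ∣ X ∣ → Z Y ≡ 0ℤ
    Z-below-X Y lt = decidable-stable (Z Y ℤ.≟ 0ℤ) (X-minimal Y lt)

    s<∣X∣ : s < ∣ X ∣
    s<∣X∣ = ℕ.≰⇒> (Z-X≢0 ∘ Z-small X)

    κ₀-zero-on-X : ∀ {j} → j ∈ˢ X → lookup κ₀ j ≡ zero
    κ₀-zero-on-X {j} j∈X with ⟪⟫≢0⇒∃ L (test X κ₀) Z-X≢0
    ... | (_ , v) , _ , test≢0 with exactTest≢0 X [] κ₀ v (test≢0 ∘ trans (sym (exactTest-[] X κ₀ v)))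
    ... | key≡κ₀ , zX , _ = begin
      lookup κ₀ j             ≡⟨ cong (λ κ → lookup κ j) key≡κ₀ ⟨
      lookup (key v) j        ≡⟨ Vec.lookup-map j eraseOne v ⟩
      eraseOne (lookup v j)   ≡⟨ cong eraseOne (zeroOn-sound X v zX j∈X) ⟩
      zero                    ∎
      where open ≡-Reasoning

    ∪⁅⁆⊆X : ∀ {B j} → B ⊆ X → j ∈ˢ X → B ∪ ⁅ j ⁆ ⊆ X
    ∪⁅⁆⊆X {B} {j} B⊆X j∈X i∈ with Subset.x∈p∪q⁻ B ⁅ j ⁆ i∈
    ... | inj₁ i∈B = B⊆X i∈B
    ... | inj₂ i∈⁅j⁆ = subst (_∈ˢ X) (sym (Subset.x∈⁅y⁆⇒x≡y j i∈⁅j⁆)) j∈X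

    -- Expanding Zₑ B D down to D = [] only meets values Z B′ with B′ ⊂ X, which vanish by minimality.
    Zₑ-missing : ∀ D {B j} → B ⊆ X → (∀ {i} → i ∈ D → i ∈ˢ X) → j ∈ˢ X → j ∉ˢ B → j ∉ D → Zₑ B D ≡ 0ℤ
    Zₑ-missing [] {B} B⊆X _ j∈X j∉B _ = trans (Zₑ-[] B) (Z-below-X B (Subset.p⊂q⇒∣p∣<∣q∣ (B⊆X , _ , j∈X , j∉B)))
    Zₑ-missing (i ∷ D) {B} {j} B⊆X D⊆X j∈X j∉B j∉D = begin
      Zₑ B (i ∷ D)                   ≡⟨ Zₑ-∷ B i D ⟩
      Zₑ B D ℤ.- Zₑ (B ∪ ⁅ i ⁆) D    ≡⟨ cong₂ ℤ._-_ (Zₑ-missing D B⊆X (D⊆X ∘ there) j∈X j∉B (j∉D ∘ there))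
                                          (Zₑ-missing D (∪⁅⁆⊆X B⊆X (D⊆X (here refl))) (D⊆X ∘ there)
                                                      j∈X j∉B∪⁅i⁆ (j∉D ∘ there)) ⟩
      0ℤ                             ∎
      where
      open ≡-Reasoning
      j∉B∪⁅i⁆ : j ∉ˢ B ∪ ⁅ i ⁆
      j∉B∪⁅i⁆ j∈ with Subset.x∈p∪q⁻ B ⁅ i ⁆ j∈
      ... | inj₁ j∈B = j∉B j∈B
      ... | inj₂ j∈⁅i⁆ = j∉D (here (Subset.x∈⁅y⁆⇒x≡y i j∈⁅i⁆))

    Zₑ-partition≢0 : ∀ D {B} → Unique D → (∀ {i} → i ∈ D → i ∉ˢ B) → (∀ {i} → i ∈ˢ X → i ∈ˢ B ⊎ i ∈ D) →
      B ⊆ X → (∀ {i} → i ∈ D → i ∈ˢ X) → Zₑ B D ≢ 0ℤ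
    Zₑ-partition≢0 [] {B} _ _ cover B⊆X _ =
      Z-X≢0 ∘ subst (λ Y → Zₑ Y [] ≡ 0ℤ → Z X ≡ 0ℤ) (sym (Subset.⊆-antisym B⊆X X⊆B)) (trans (sym (Zₑ-[] X)))
      where
      X⊆B : X ⊆ B
      X⊆B i∈X with cover i∈X
      ... | inj₁ i∈B = i∈B
    Zₑ-partition≢0 (j ∷ D) {B} (j∉D ∷ uD) D∩B=∅ cover B⊆X D⊆X Zₑ≡0 =
      Zₑ-partition≢0 D uD D∩B∪⁅j⁆=∅ cover′ (∪⁅⁆⊆X B⊆X (D⊆X (here refl))) (D⊆X ∘ there) Zₑ-B∪⁅j⁆≡0
      where
      Zₑ-B∪⁅j⁆≡0 : Zₑ (B ∪ ⁅ j ⁆) D ≡ 0ℤ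
      Zₑ-B∪⁅j⁆≡0 = begin
        Zₑ (B ∪ ⁅ j ⁆) D                         ≡⟨ ℤ.neg-involutive _ ⟨
        ℤ.- ℤ.- Zₑ (B ∪ ⁅ j ⁆) D                 ≡⟨ cong ℤ.-_ (ℤ.+-identityˡ _) ⟨
        ℤ.- (0ℤ ℤ.- Zₑ (B ∪ ⁅ j ⁆) D)            ≡⟨ cong (λ z → ℤ.- (z ℤ.- Zₑ (B ∪ ⁅ j ⁆) D)) Zₑ-B≡0 ⟨
        ℤ.- (Zₑ B D ℤ.- Zₑ (B ∪ ⁅ j ⁆) D)        ≡⟨ cong ℤ.-_ (trans (sym (Zₑ-∷ B j D)) Zₑ≡0) ⟩
        0ℤ                                       ∎
        where
        open ≡-Reasoning
        Zₑ-B≡0 : Zₑ B D ≡ 0ℤ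
        Zₑ-B≡0 = Zₑ-missing D B⊆X (D⊆X ∘ there) (D⊆X (here refl)) (D∩B=∅ (here refl)) (λ j∈D → All.lookup j∉D j∈D refl)
      D∩B∪⁅j⁆=∅ : ∀ {i} → i ∈ D → i ∉ˢ B ∪ ⁅ j ⁆
      D∩B∪⁅j⁆=∅ i∈D i∈ with Subset.x∈p∪q⁻ B ⁅ j ⁆ i∈
      ... | inj₁ i∈B = D∩B=∅ (there i∈D) i∈B
      ... | inj₂ i∈⁅j⁆ = All.lookup j∉D i∈D (sym (Subset.x∈⁅y⁆⇒x≡y j i∈⁅j⁆))
      cover′ : ∀ {i} → i ∈ˢ X → i ∈ˢ B ∪ ⁅ j ⁆ ⊎ i ∈ D
      cover′ i∈X with cover i∈X
      ... | inj₁ i∈B = inj₁ (Subset.x∈p∪q⁺ (inj₁ i∈B))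
      ... | inj₂ (here refl) = inj₁ (Subset.x∈p∪q⁺ (inj₂ (Subset.x∈⁅x⁆ _)))
      ... | inj₂ (there i∈D) = inj₂ i∈D

    module Realise (f : Fin n → Fin (2 + r)) where

      B : Subset n
      B = X ∩ zeros (Vec.tabulate f)

      InD : Fin n → Set
      InD i = i ∈ˢ X × f i ≢ zero

      InD? : Decidable InD
      InD? i = (i Subset.∈? X) ×-dec ¬? (f i Fin.≟ zero)

      D : List (Fin n)
      D = filter InD? (allFin n)

      unique-D : Unique D
      unique-D = Unique.filter⁺ InD? (Unique.allFin⁺ n)

      ∈D⁺ : ∀ {i} → InD i → i ∈ D
      ∈D⁺ {i} = ∈-filter⁺ InD? (∈-allFin i)

      ∈D⁻ : ∀ {i} → i ∈ D → InD i
      ∈D⁻ = proj₂ ∘ ∈-filter⁻ InD? {xs = allFin n}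

      ∈B⁺ : ∀ {i} → i ∈ˢ X → f i ≡ zero → i ∈ˢ B
      ∈B⁺ {i} i∈X fi≡0 = Subset.x∈p∩q⁺ (i∈X , ∈-zeros⁺ (Vec.tabulate f) (trans (Vec.lookup∘tabulate f i) fi≡0))

      ∈B⁻ : ∀ {i} → i ∈ˢ B → i ∈ˢ X × f i ≡ zero
      ∈B⁻ {i} i∈B with Subset.x∈p∩q⁻ X _ i∈B
      ... | i∈X , i∈zeros = i∈X , trans (sym (Vec.lookup∘tabulate f i)) (∈-zeros⁻ (Vec.tabulate f) i∈zeros)

      cover : ∀ {i} → i ∈ˢ X → i ∈ˢ B ⊎ i ∈ D
      cover {i} i∈X with f i Fin.≟ zero
      ... | yes fi≡0 = inj₁ (∈B⁺ i∈X fi≡0)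
      ... | no fi≢0 = inj₂ (∈D⁺ (i∈X , fi≢0))

      Zₑ-B-D≢0 : Zₑ B D ≢ 0ℤ
      Zₑ-B-D≢0 = Zₑ-partition≢0 D unique-D
        (λ i∈D i∈B → proj₂ (∈D⁻ i∈D) (proj₂ (∈B⁻ i∈B))) cover (proj₁ ∘ ∈B⁻) (proj₁ ∘ ∈D⁻)

      -- A member counted by Zₑ B D has key κ₀, which is 0 on X, so it is 1 on D: recolour it to f there.
      realised : ∃ λ u → u ∈ V × (∀ i → i ∈ˢ X → lookup u i ≡ f i)
      realised with ⟪⟫≢0⇒∃ L (exactTest B D κ₀) Zₑ-B-D≢0
      ... | (_ , v) , p∈ , ≢0 with exactTest≢0 B D κ₀ v ≢0
      ... | key≡κ₀ , zB , v≢0-on-D with closed-recolour closed f D unique-D (supported p∈) v≡1-on-D (proj₂ ∘ ∈D⁻)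
        where
        v≡1-on-D : ∀ {j} → j ∈ D → lookup v j ≡ one
        v≡1-on-D {j} j∈D = eraseOne≡zero (lookup v j) erased≡0 (v≢0-on-D j∈D)
          where
          erased≡0 : eraseOne (lookup v j) ≡ zero
          erased≡0 = trans (sym (Vec.lookup-map j eraseOne v))
                           (trans (cong (λ κ → lookup κ j) key≡κ₀) (κ₀-zero-on-X (proj₁ (∈D⁻ j∈D))))
      ... | u , u∈ , agrees , unchanged = u , u∈ , agrees-on-X
        where
        agrees-on-X : ∀ i → i ∈ˢ X → lookup u i ≡ f i
        agrees-on-X i i∈X with f i Fin.≟ zero
        ... | yes fi≡0 = begin
          lookup u i   ≡⟨ unchanged i (λ i∈D → proj₂ (∈D⁻ i∈D) fi≡0) ⟩
          lookup v i   ≡⟨ zeroOn-sound B v zB (∈B⁺ i∈X fi≡0) ⟩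
          zero         ≡⟨ fi≡0 ⟨
          f i          ∎
          where open ≡-Reasoning
        ... | no fi≢0 = agrees (∈D⁺ (i∈X , fi≢0))

    shatters-X : Shatters V X
    shatters-X = Realise.realised

    shattered-subset : ∃ λ S → ∣ S ∣ ≡ s + 1 × Shatters V S
    shattered-subset with subset-of-size X (subst (_≤ ∣ X ∣) (ℕ.+-comm 1 s) s<∣X∣)
    ... | Y , Y⊆X , ∣Y∣≡s+1 = Y , ∣Y∣≡s+1 , shatters-⊆ Y⊆X shatters-X

  shattered-subset : ∃ λ S → ∣ S ∣ ≡ s + 1 × Shatters V S
  shattered-subset with minimal-subset (λ Y → ¬? (Z Y ℤ.≟ 0ℤ)) {zeros v₀}
    (proj₂ (proj₂ nontrivial) ∘ trans (sym Z-zeros-v₀))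
  ... | X , Z-X≢0 , X-minimal = Minimal.shattered-subset X Z-X≢0 X-minimal

theorem5 : (n q d s : ℕ) → 1 ≤ n → 2 ≤ q → d ≤ n → d + s ≤ n →
    (𝒱 : List (Tuple q n)) → Unique 𝒱 → IsHamming d 𝒱 →
    ((S : Subset n) → ∣ S ∣ ≡ s + 1 → ¬ Shatters 𝒱 S) →
    length 𝒱 ≤ bound n q d s
theorem5 n (suc (suc r)) d s _ (s≤s (s≤s z≤n)) _ d+s≤n 𝒱 unique-𝒱 hamming-𝒱 no-shattering =
  ℕ.≮⇒≥ (too-large (compress 𝒱 unique-𝒱 hamming-𝒱))
  where
  module _ (𝒞 : Compression d 𝒱) where
    open Compression 𝒞

    too-large : bound n (2 + r) d s < length 𝒱 → ⊥
    too-large bound<∣𝒱∣ = refute (FromAnnihilator.shattered-subset hamming closed d+s≤n 𝒜)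
      where
      𝒜 : Annihilator (tests n s d) tuples
      𝒜 = annihilator (tests n s d) unique (subst₂ _<_ (sym (length-tests r n s d)) (sym same-length) bound<∣𝒱∣)
      refute : (∃ λ S → ∣ S ∣ ≡ s + 1 × Shatters tuples S) → ⊥
      refute (S , ∣S∣≡s+1 , shatters) = no-shattering S ∣S∣≡s+1 (reflects S shatters)
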